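{- (i) The subalgebra $\mathbb Q\langle v_1,v_2,v_3,\dots\rangle\subset\mathbb Q\langle V\rangle$ is closed under $\circledast_a$ and the shuffle coproduct $\Delta$, so that $(\mathbb Q\langle v_1,v_2,\dots\rangle,\circledast_a,\Delta)$ is a Hopf subalgebra of $(\mathbb Q\langle V\rangle,\circledast_a,\Delta)$. (ii) $(\mathbb Q\langle v_1,v_2,\dots\rangle,⧢,\Delta_a)$ is a Hopf subalgebra of $(\mathbb Q\langle V\rangle,⧢,\Delta_a)$.
   Context: $V=\{v_0,v_1,\dots\}$ with weight $\mathrm{wt}(v_0)=1$, $\mathrm{wt}(v_i)=i$. Ari multiplicity $\mathrm m_{\mathbf k,\mathbf l}=(-1)^{|\mathbf k|+|\mathbf l|}\prod_i\binom{k_i-1}{l_i-1}$ with $\binom{ -1}{ -1}=1$, $\binom{k-1}{ -1}=\binom{ -1}{l-1}=0$ for $k,l>0$, usual binomials otherwise. $\mathbb Q\langle V\rangle=U(\mathrm{Lie}(V))$ with concatenation, shuffle coproduct $\Delta$ (letters primitive, Sweedler notation) and shuffle product $⧢$. $\triangleright_a$ is the post-Lie product on the free Lie algebra $\mathrm{Lie}(V)$ obtained from the free magma (product $\star$): for a bracketing $t(\mathbf k)$ of $v_{k_1},\dots,v_{k_r}$, $t(\mathbf k)\triangleright_av_0=0$ and $t(\mathbf k)\triangleright_av_s=\sum_{\mathbf l}\mathrm m_{\mathbf k,\mathbf l}v_{s+|\mathbf k|-|\mathbf l|}\star t(\mathbf l)$ ($s\ge1$), extended linearly in $t$, as a derivation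 in the second argument, and descended via $a\star b\mapsto[a,b]$; it is extended to $\mathbb Q\langle V\rangle^{\otimes2}$ by $x\triangleright\mathbf1=0$, $\mathbf1\triangleright A=A$, $xA\triangleright y=x\triangleright(A\triangleright y)-(x\triangleright A)\triangleright y$, $A\triangleright BC=(A_{(1)}\triangleright B)(A_{(2)}\triangleright C)$. The Grossman–Larson product $A\circledast_aB=A_{(1)}(A_{(2)}\triangleright_aB)$ makes $(\mathbb Q\langle V\rangle,\circledast_a,\Delta)$ a Hopf algebra; $\Delta_a$ is its dual coproduct for the pairing making words orthonormal, so $(\mathbb Q\langle V\rangle,⧢,\Delta_a)$ is the graded dual Hopf algebra. -}

module Defs where

-- Formalisation of the objects of Proposition 4.32.
-- Q<V> : letters v_k are natural numbers k, words are List ℕ,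
-- elements of Q<V> are finite formal Q-linear combinations of words
-- (List (ℚ × Word)); two such lists denote the same element iff all
-- coefficients `coeff` agree, and every statement below only looks at
-- coefficients, so it is independent of the chosen representative.

open import Data.Nat as ℕ using (ℕ; zero; suc; _∸_)
open import Data.Nat.Combinatorics using (_C_)
open import Data.Integer using (+_)
open import Data.Rational using (ℚ; 0ℚ; 1ℚ; _+_; _*_; -_; _/_)
open import Data.List using (List; []; _∷_; _++_; map; concatMap; length; foldr; upTo)
open import Data.List.Relation.Unary.All using (All)
open import Data.List.Properties using (≡-dec)
open import Data.Product using (_×_; _,_)
open import Data.Bool using (Bool; true; false; if_then_else_)
open import Relation.Nullary using (¬_; yes; no)
open import Relation.Nullary.Decidable using (⌊_⌋)
open import Relation.Binary.PropositionalEquality using (_≡_; _≢_)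

Word : Set
Word = List ℕ

Poly : Set
Poly = List (ℚ × Word)

-- element of Q<V> ⊗ Q<V>
Poly2 : Set
Poly2 = List (ℚ × Word × Word)

ℕtoℚ : ℕ → ℚ
ℕtoℚ n = (+ n) / 1

_≟w_ : (u w : Word) → Bool
u ≟w w = ⌊ ≡-dec ℕ._≟_ u w ⌋

coeff : Poly → Word → ℚ
coeff [] w = 0ℚ
coeff ((c , u) ∷ P) w = (if u ≟w w then c else 0ℚ) + coeff P w

coeff2 : Poly2 → Word → Word → ℚ
coeff2 [] u w = 0ℚ
coeff2 ((c , u' , w') ∷ T) u w =
  (if u' ≟w u then (if w' ≟w w then c else 0ℚ) else 0ℚ) + coeff2 T u w

scale : ℚ → Poly → Poly
scale a = map (λ { (c , w) → (a * c , w) })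

neg : Poly → Poly
neg = scale (- 1ℚ)

word : Word → Poly
word w = (1ℚ , w) ∷ []

one : Poly
one = word []

_·_ : Poly → Poly → Poly
P · Q = concatMap (λ { (c , u) → map (λ { (d , w) → (c * d , u ++ w) }) Q }) P

-- Subsequence splittings: all pairs (w_I , w_{I^c}) for I ⊆ positions
-- (with multiplicity). This is the shuffle coproduct of a word.

splits : {A : Set} → List A → List (List A × List A)
splits [] = ([] , []) ∷ []
splits (x ∷ xs) =
  concatMap (λ { (a , b) → (x ∷ a , b) ∷ (a , x ∷ b) ∷ [] }) (splits xs)

Δ : Poly → Poly2
Δ P = concatMap (λ { (c , w) → map (λ { (a , b) → (c , a , b) }) (splits w) }) P

shuffleW : Word → Word → Poly
shuffleW [] w = word w
shuffleW (x ∷ u) [] = word (x ∷ u)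
shuffleW (x ∷ u) (y ∷ w) =
  map (λ { (c , r) → (c , x ∷ r) }) (shuffleW u (y ∷ w)) ++
  map (λ { (c , r) → (c , y ∷ r) }) (shuffleW (x ∷ u) w)

_⧢_ : Poly → Poly → Poly
P ⧢ Q = concatMap (λ { (c , u) → concatMap (λ { (d , w) → scale (c * d) (shuffleW u w) }) Q }) P

data Tree : Set where
  leaf : ℕ → Tree
  node : Tree → Tree → Tree      -- node a b  =  a ⋆ b

MPoly : Set
MPoly = List (ℚ × Tree)

leaves : Tree → List ℕ
leaves (leaf k) = k ∷ []
leaves (node a b) = leaves a ++ leaves b

sumℕ : List ℕ → ℕ
sumℕ = foldr ℕ._+_ 0

sign : ℕ → ℚ
sign zero = 1ℚ
sign (suc zero) = - 1ℚ
sign (suc (suc n)) = sign n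

-- binomial  binom(k-1, l-1)  with the conventions of the paper:
-- binom(-1,-1) = 1, binom(k-1,-1) = binom(-1,l-1) = 0 for k,l > 0
binom₋₁ : ℕ → ℕ → ℕ
binom₋₁ zero zero = 1
binom₋₁ zero (suc l) = 0
binom₋₁ (suc k) zero = 0
binom₋₁ (suc k) (suc l) = k C l

prodℚ : List ℚ → ℚ
prodℚ = foldr _*_ 1ℚ

zipWithB : List ℕ → List ℕ → List ℚ
zipWithB (k ∷ ks) (l ∷ ls) = ℕtoℚ (binom₋₁ k l) ∷ zipWithB ks ls
zipWithB _ _ = []

mult : List ℕ → List ℕ → ℚ
mult ks ls = sign (sumℕ ks ℕ.+ sumℕ ls) * prodℚ (zipWithB ks ls)

-- all tuples l with 0 ≤ l_i ≤ k_i  (this contains the support of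
-- l ↦ m_{k,l}: outside it the binomials vanish)
boxes : List ℕ → List (List ℕ)
boxes [] = [] ∷ []
boxes (k ∷ ks) = concatMap (λ l → map (l ∷_) (boxes ks)) (upTo (suc k))

relabel' : Tree → List ℕ → Tree × List ℕ
relabel' (leaf k) [] = leaf k , []
relabel' (leaf k) (l ∷ ls) = leaf l , ls
relabel' (node a b) ls with relabel' a ls
... | a' , ls' with relabel' b ls'
... | b' , ls'' = node a' b' , ls''

relabel : Tree → List ℕ → Tree
relabel t ls with relabel' t ls
... | t' , _ = t'

_▷ₘ_ : Tree → Tree → MPoly
t ▷ₘ leaf zero = []
t ▷ₘ leaf (suc s) =
  map (λ ls → (mult (leaves t) ls ,
               node (leaf (suc s ℕ.+ sumℕ (leaves t) ∸ sumℕ ls)) (relabel t ls)))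
      (boxes (leaves t))
t ▷ₘ node a b =
  map (λ { (c , a') → (c , node a' b) }) (t ▷ₘ a) ++
  map (λ { (c , b') → (c , node a b') }) (t ▷ₘ b)

_▷ₘ*_ : Tree → MPoly → MPoly
t ▷ₘ* P = concatMap (λ { (c , u) → map (λ { (d , r) → (c * d , r) }) (t ▷ₘ u) }) P

-- descent to Lie(V) ⊂ Q<V>: a ⋆ b ↦ [a , b] = ab - ba
lieW : Tree → Poly
lieW (leaf k) = word (k ∷ [])
lieW (node a b) = (lieW a · lieW b) ++ neg (lieW b · lieW a)

lieP : MPoly → Poly
lieP = concatMap (λ { (c , t) → scale c (lieW t) })

-- Extension to U(Lie(V)) = Q<V>.
-- An element of U(Lie(V)) is represented as a combination of products
-- t_1 ⋯ t_n of Lie elements, each given by a magma representative.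

UPoly : Set
UPoly = List (ℚ × List Tree)

actU : Tree → List Tree → UPoly
actU t [] = []
actU t (u ∷ us) =
  map (λ { (c , u') → (c , u' ∷ us) }) (t ▷ₘ u) ++
  map (λ { (c , us') → (c , u ∷ us') }) (actU t us)

-- (t_1 ⋯ t_n) ▷ u  for a Lie element u, via  1 ▷ u = u  and
--   tA ▷ u = t ▷ (A ▷ u) - (t ▷ A) ▷ u ;
-- the fuel n is the length of the product (preserved by t ▷ _).
actL : ℕ → List Tree → Tree → MPoly
actL _ [] u = (1ℚ , u) ∷ []
actL zero (t ∷ A) u = []
actL (suc n) (t ∷ A) u =
  (t ▷ₘ* actL n A u) ++
  concatMap (λ { (c , A') → map (λ { (d , r) → (- (c * d) , r) }) (actL n A' u) }) (actU t A)

_▷L_ : Word → Tree → MPoly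
A ▷L u = actL (length A) (map leaf A) u

εW : Word → ℚ
εW [] = 1ℚ
εW (_ ∷ _) = 0ℚ

_▷W_ : Word → Word → Poly
A ▷W [] = (εW A , []) ∷ []
A ▷W (b ∷ C) =
  concatMap (λ { (A₁ , A₂) → lieP (A₁ ▷L leaf b) · (A₂ ▷W C) }) (splits A)

_⊛W_ : Word → Word → Poly
A ⊛W B = concatMap (λ { (A₁ , A₂) → word A₁ · (A₂ ▷W B) }) (splits A)

_⊛ₐ_ : Poly → Poly → Poly
P ⊛ₐ Q = concatMap (λ { (c , u) → concatMap (λ { (d , w) → scale (c * d) (u ⊛W w) }) Q }) P

-- antipode S of (Q<V>, ⊛ₐ, Δ), the unique map with
--   Σ S(w₍₁₎) ⊛ₐ w₍₂₎ = ε(w) 1 ,  i.e.  S(1) = 1 and, for w ≠ 1,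
--   S(w) = - Σ_{I ≠ all positions} S(w_I) ⊛ₐ w_{I^c}
-- (recursion on length; fuel = length, since |w_I| < |w| there).
antipodeF : ℕ → Word → Poly
antipodeF _ [] = one
antipodeF zero (_ ∷ _) = []
antipodeF (suc n) (x ∷ w) = concatMap term (splits (x ∷ w))
  where
  term : Word × Word → Poly
  term (a , []) = []
  term (a , b ∷ bs) = neg (antipodeF n a ⊛ₐ word (b ∷ bs))

antipodeW : Word → Poly
antipodeW w = antipodeF (length w) w

antipode : Poly → Poly
antipode P = concatMap (λ { (c , w) → scale c (antipodeW w) }) P

-- The graded dual (Q<V>, ⧢, Δₐ): Δₐ is dual to ⊛ₐ and its antipode is
-- the transpose of S, for the pairing making words orthonormal.

Δₐ-coeff : Poly → Word → Word → ℚ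
Δₐ-coeff P u v = foldr _+_ 0ℚ (map (λ { (c , w) → c * coeff (word u ⊛ₐ word v) w }) P)

antipodeᵗ-coeff : Poly → Word → ℚ
antipodeᵗ-coeff P u = foldr _+_ 0ℚ (map (λ { (c , w) → c * coeff (antipodeW u) w }) P)

NoV0 : Word → Set
NoV0 w = All (λ k → k ≢ 0) w

InSub : Poly → Set
InSub P = ∀ w → coeff P w ≢ 0ℚ → NoV0 w

InSub2 : Poly2 → Set
InSub2 T = ∀ u w → coeff2 T u w ≢ 0ℚ → NoV0 u × NoV0 w

Δₐ-InSub2 : Poly → Set
Δₐ-InSub2 P = ∀ u v → Δₐ-coeff P u v ≢ 0ℚ → NoV0 u × NoV0 v

antipodeᵗ-InSub : Poly → Set
antipodeᵗ-InSub P = ∀ u → antipodeᵗ-coeff P u ≢ 0ℚ → NoV0 u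

-- Let the v₀-degree of a word be its number of letters v₀. Every
-- structure map respects this grading: concatenation, shuffle and the shuffle
-- coproduct obviously; the post-Lie product t(k) ▷ₐ v_s because the ari
-- multiplicity m_{k,l} vanishes unless l_i = 0 exactly when k_i = 0, while the
-- new letter v_{s+|k|-|l|} has positive index. Hence ⊛ₐ, Δ and the antipode
-- (defined recursively from ⊛ₐ) preserve degree and map the degree-0 part
-- Q⟨v₁,v₂,…⟩ into itself. Dually, ⟨P , u ⊛ₐ v⟩ and ⟨P , S(u)⟩ vanish for P of
-- degree 0 unless u and v have degree 0, which is (ii). As the terms of a
-- combination may cancel, the degree bounds, which hold term by term, reach
-- the coefficients through pair≡0.

module Submission where

open import Defs
open import Algebra.Bundles using (CommutativeMonoid)
import Algebra.Properties.CommutativeSemigroup as CommSemigroupProperties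
open import Data.Bool using (true; false; if_then_else_)
open import Data.Empty using (⊥-elim)
open import Data.List using (List; []; _∷_; _++_; map; concatMap; length; foldr)
open import Data.List.Properties using (≡-dec; ++-assoc; ++-identityʳ)
open import Data.List.Relation.Unary.All as All using (All; []; _∷_)
open import Data.List.Relation.Unary.All.Properties using (map⁺; ++⁺; concat⁺; all-upTo)
open import Data.List.Relation.Binary.Pointwise as Pointwise using (Pointwise; []; _∷_)
open import Data.Nat as ℕ using (ℕ; zero; suc; _+_; _∸_; _≤_; _≥_; s≤s)
import Data.Nat.Properties as ℕₚ
open import Data.Product using (_×_; _,_; proj₁; proj₂)
open import Data.Rational as ℚ using (ℚ; 0ℚ; 1ℚ; _*_; -_)
import Data.Rational.Properties as ℚₚ
open import Data.Sum as Sum using (_⊎_; inj₁; inj₂)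
open import Relation.Nullary using (yes; no)
open import Relation.Binary.PropositionalEquality
  using (_≡_; _≢_; refl; sym; trans; cong; cong₂; subst; subst₂; module ≡-Reasoning)

open CommSemigroupProperties ℕₚ.+-commutativeSemigroup using (x∙yz≈y∙xz; interchange)

≟w-true : ∀ {u w} → u ≟w w ≡ true → u ≡ w
≟w-true {u} {w} eq with ≡-dec ℕ._≟_ u w
... | yes u≡w = u≡w

≟w-≢ : ∀ {u w} → u ≢ w → u ≟w w ≡ false
≟w-≢ {u} {w} u≢w with ≡-dec ℕ._≟_ u w
... | yes u≡w = ⊥-elim (u≢w u≡w)
... | no _ = refl

≟w-refl : ∀ u → u ≟w u ≡ true
≟w-refl u with ≡-dec ℕ._≟_ u u
... | yes _ = refl
... | no u≢u = ⊥-elim (u≢u refl)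

-- The v₀-degree

δ₀ : ℕ → ℕ
δ₀ zero    = 1
δ₀ (suc _) = 0

v₀-count : Word → ℕ
v₀-count []      = 0
v₀-count (k ∷ w) = δ₀ k + v₀-count w

v₀-count-++ : ∀ u w → v₀-count (u ++ w) ≡ v₀-count u + v₀-count w
v₀-count-++ []      w = refl
v₀-count-++ (k ∷ u) w =
  trans (cong (δ₀ k +_) (v₀-count-++ u w)) (sym (ℕₚ.+-assoc (δ₀ k) _ _))

v₀-count≡0⇒NoV0 : ∀ w → v₀-count w ≡ 0 → NoV0 w
v₀-count≡0⇒NoV0 []          _  = []
v₀-count≡0⇒NoV0 (suc k ∷ w) w₀ = (λ ()) ∷ v₀-count≡0⇒NoV0 w w₀

NoV0⇒v₀-count≡0 : ∀ {w} → NoV0 w → v₀-count w ≡ 0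
NoV0⇒v₀-count≡0 {[]}        []          = refl
NoV0⇒v₀-count≡0 {zero ∷ _}  (0≢0 ∷ _)   = ⊥-elim (0≢0 refl)
NoV0⇒v₀-count≡0 {suc _ ∷ _} (_ ∷ noV0)  = NoV0⇒v₀-count≡0 noV0

v₀-count₂ : Word × Word → ℕ
v₀-count₂ (u , w) = v₀-count u + v₀-count w

v₀-count₂≡0⇒NoV0 : ∀ u w → v₀-count₂ (u , w) ≡ 0 → NoV0 u × NoV0 w
v₀-count₂≡0⇒NoV0 u w uw₀ =
  v₀-count≡0⇒NoV0 u (ℕₚ.m+n≡0⇒m≡0 _ uw₀) , v₀-count≡0⇒NoV0 w (ℕₚ.m+n≡0⇒n≡0 _ uw₀)

v₀-countᵗ : Tree → ℕ
v₀-countᵗ (leaf k)   = δ₀ k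
v₀-countᵗ (node a b) = v₀-countᵗ a + v₀-countᵗ b

v₀-countᵗ≡v₀-count-leaves : ∀ t → v₀-countᵗ t ≡ v₀-count (leaves t)
v₀-countᵗ≡v₀-count-leaves (leaf k)   = sym (ℕₚ.+-identityʳ (δ₀ k))
v₀-countᵗ≡v₀-count-leaves (node a b) =
  trans (cong₂ _+_ (v₀-countᵗ≡v₀-count-leaves a) (v₀-countᵗ≡v₀-count-leaves b))
        (sym (v₀-count-++ (leaves a) (leaves b)))

v₀-countᶠ : List Tree → ℕ
v₀-countᶠ []       = 0
v₀-countᶠ (t ∷ ts) = v₀-countᵗ t + v₀-countᶠ ts

v₀-countᶠ-map-leaf : ∀ w → v₀-countᶠ (map leaf w) ≡ v₀-count w
v₀-countᶠ-map-leaf []      = refl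
v₀-countᶠ-map-leaf (k ∷ w) = cong (δ₀ k +_) (v₀-countᶠ-map-leaf w)

degree-raiseˡ : ∀ t a b {d} → d ≡ t + a → d + b ≡ t + (a + b)
degree-raiseˡ t a b d≡t+a = trans (cong (_+ b) d≡t+a) (ℕₚ.+-assoc t a b)

degree-raiseʳ : ∀ t a b {d} → d ≡ t + b → a + d ≡ t + (a + b)
degree-raiseʳ t a b d≡t+b = trans (cong (a +_) d≡t+b) (x∙yz≈y∙xz a t b)

Homogeneous : {A : Set} → (A → ℕ) → ℕ → List (ℚ × A) → Set
Homogeneous deg n = All (λ e → proj₁ e ≡ 0ℚ ⊎ deg (proj₂ e) ≡ n)

mapCoeff : {A : Set} → (ℚ → ℚ) → List (ℚ × A) → List (ℚ × A)
mapCoeff k = map (λ e → (k (proj₁ e) , proj₂ e))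

module _ {A : Set} {deg : A → ℕ} {n : ℕ} where

  Homogeneous-mapCoeff : ∀ {k xs} → k 0ℚ ≡ 0ℚ →
    Homogeneous deg n xs → Homogeneous deg n (mapCoeff k xs)
  Homogeneous-mapCoeff {k} k0≡0 hom =
    map⁺ (All.map (Sum.map₁ (λ c≡0 → trans (cong k c≡0) k0≡0)) hom)

  Homogeneous-mapCoeff-zero : ∀ {k} → (∀ c → k c ≡ 0ℚ) →
    ∀ xs → Homogeneous deg n (mapCoeff k xs)
  Homogeneous-mapCoeff-zero k≡0 []       = []
  Homogeneous-mapCoeff-zero k≡0 (e ∷ xs) = inj₁ (k≡0 (proj₁ e)) ∷ Homogeneous-mapCoeff-zero k≡0 xs

Homogeneous-mapKeys : ∀ {A B : Set} {degA : A → ℕ} {degB : B → ℕ} {m n} (f : A → B) →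
  (∀ {x} → degA x ≡ m → degB (f x) ≡ n) →
  ∀ {xs} → Homogeneous degA m xs → Homogeneous degB n (map (λ e → (proj₁ e , f (proj₂ e))) xs)
Homogeneous-mapKeys f deg-f hom = map⁺ (All.map (Sum.map₂ deg-f) hom)

Homogeneous-concatMap : ∀ {A B : Set} {P : A → Set} {deg : B → ℕ} {n}
  {f : A → List (ℚ × B)} {ys} →
  (∀ {y} → P y → Homogeneous deg n (f y)) → All P ys → Homogeneous deg n (concatMap f ys)
Homogeneous-concatMap hom-f ps = concat⁺ (map⁺ (All.map hom-f ps))

-- k = _*_ covers ▷ₘ* and lieP; actL needs k c d = - (c * d).
Homogeneous-linear : ∀ {A B : Set} {degA : A → ℕ} {degB : B → ℕ} {m n}
  (k : ℚ → ℚ → ℚ) → (∀ d → k 0ℚ d ≡ 0ℚ) → (∀ c → k c 0ℚ ≡ 0ℚ) →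
  {F : A → List (ℚ × B)} → (∀ x → degA x ≡ m → Homogeneous degB n (F x)) →
  ∀ {xs} → Homogeneous degA m xs →
  Homogeneous degB n (concatMap (λ e → mapCoeff (k (proj₁ e)) (F (proj₂ e))) xs)
Homogeneous-linear k k0d≡0 kc0≡0 hom-F = Homogeneous-concatMap λ where
  (inj₁ c≡0)   → Homogeneous-mapCoeff-zero (λ d → trans (cong (λ c → k c d) c≡0) (k0d≡0 d)) _
  (inj₂ deg≡m) → Homogeneous-mapCoeff (kc0≡0 _) (hom-F _ deg≡m)

zero-or-* : ∀ {c d} {X Y : Set} → c ≡ 0ℚ ⊎ X → d ≡ 0ℚ ⊎ Y → c * d ≡ 0ℚ ⊎ X × Y
zero-or-* {d = d} (inj₁ refl) _           = inj₁ (ℚₚ.*-zeroˡ d)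
zero-or-* {c = c} (inj₂ _)    (inj₁ refl) = inj₁ (ℚₚ.*-zeroʳ c)
zero-or-* (inj₂ x)    (inj₂ y)    = inj₂ (x , y)

word-homogeneous : ∀ w → Homogeneous v₀-count (v₀-count w) (word w)
word-homogeneous w = inj₂ refl ∷ []

Homogeneous-· : ∀ {m n P R} → Homogeneous v₀-count m P → Homogeneous v₀-count n R →
  Homogeneous v₀-count (m + n) (P · R)
Homogeneous-· homP homR = Homogeneous-concatMap
  (λ {e} hu → map⁺ (All.map (λ {e'} hw → Sum.map₂ (λ (u≡m , w≡n) →
    trans (v₀-count-++ (proj₂ e) (proj₂ e')) (cong₂ _+_ u≡m w≡n)) (zero-or-* hu hw)) homR))
  homP

bilinear : (Word → Word → Poly) → Poly → Poly → Poly
bilinear op P R =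
  concatMap (λ e → concatMap (λ e' → scale (proj₁ e * proj₁ e') (op (proj₂ e) (proj₂ e'))) R) P

Graded : (Word → Word → Poly) → Set
Graded op = ∀ u w → Homogeneous v₀-count (v₀-count₂ (u , w)) (op u w)

Homogeneous-bilinear : ∀ op → Graded op → ∀ {m n P R} →
  Homogeneous v₀-count m P → Homogeneous v₀-count n R →
  Homogeneous v₀-count (m + n) (bilinear op P R)
Homogeneous-bilinear op graded {m} {n} homP homR =
  Homogeneous-concatMap (λ hu → Homogeneous-concatMap (λ hw → term (zero-or-* hu hw)) homR) homP
  where
  term : ∀ {c u w} → c ≡ 0ℚ ⊎ v₀-count u ≡ m × v₀-count w ≡ n →
    Homogeneous v₀-count (m + n) (scale c (op u w))
  term (inj₁ c≡0) =
    Homogeneous-mapCoeff-zero (λ d → trans (cong (_* d) c≡0) (ℚₚ.*-zeroˡ d)) _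
  term {c} {u} {w} (inj₂ (u≡m , w≡n)) = Homogeneous-mapCoeff (ℚₚ.*-zeroʳ c)
    (subst (λ k → Homogeneous v₀-count k (op u w)) (cong₂ _+_ u≡m w≡n) (graded u w))

coeff-homogeneous : ∀ {n P w} → Homogeneous v₀-count n P → v₀-count w ≢ n → coeff P w ≡ 0ℚ
coeff-homogeneous {P = []} [] _ = refl
coeff-homogeneous {n} {(c , u) ∷ P} {w} (hu ∷ hom) w≢n =
  trans (cong₂ ℚ._+_ (head hu) (coeff-homogeneous hom w≢n)) (ℚₚ.+-identityˡ 0ℚ)
  where
  head : c ≡ 0ℚ ⊎ v₀-count u ≡ n → (if u ≟w w then c else 0ℚ) ≡ 0ℚ
  head hu with u ≟w w in u≟w
  head _          | false = refl
  head (inj₁ c≡0) | true  = c≡0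
  head (inj₂ u≡n) | true  = ⊥-elim (w≢n (subst (λ z → v₀-count z ≡ n) (≟w-true u≟w) u≡n))

-- Every structure map preserves the v₀-degree

DegreeSplit : Word → Word × Word → Set
DegreeSplit w p = v₀-count₂ p ≡ v₀-count w

splits-v₀-count : ∀ w → All (DegreeSplit w) (splits w)
splits-v₀-count []      = refl ∷ []
splits-v₀-count (x ∷ w) = concat⁺ (map⁺ (All.map
  (λ {(a , b)} split →
       trans (ℕₚ.+-assoc (δ₀ x) (v₀-count a) (v₀-count b)) (cong (δ₀ x +_) split)
     ∷ trans (x∙yz≈y∙xz (v₀-count a) (δ₀ x) (v₀-count b)) (cong (δ₀ x +_) split) ∷ [])
  (splits-v₀-count w)))

shuffleW-graded : Graded shuffleW
shuffleW-graded []      w       = inj₂ refl ∷ []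
shuffleW-graded (x ∷ u) []      = inj₂ (sym (ℕₚ.+-identityʳ _)) ∷ []
shuffleW-graded (x ∷ u) (y ∷ w) =
  ++⁺ (Homogeneous-mapKeys (x ∷_) (λ h → trans (cong (δ₀ x +_) h) (sym (ℕₚ.+-assoc (δ₀ x) U Y+W)))
                           (shuffleW-graded u (y ∷ w)))
      (Homogeneous-mapKeys (y ∷_) (λ h → trans (cong (δ₀ y +_) h) (x∙yz≈y∙xz (δ₀ y) X+U W))
                           (shuffleW-graded (x ∷ u) w))
  where
  U = v₀-count u
  W = v₀-count w
  X+U = δ₀ x + U
  Y+W = δ₀ y + W

boxes-bounded : ∀ ks → All (Pointwise _≥_ ks) (boxes ks)
boxes-bounded []       = [] ∷ []
boxes-bounded (k ∷ ks) = concat⁺ (map⁺ (All.map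
  (λ l<1+k → map⁺ (All.map (ℕₚ.≤-pred l<1+k ∷_) (boxes-bounded ks)))
  (all-upTo (suc k))))

sumℕ-mono : ∀ {ks ls} → Pointwise _≥_ ks ls → sumℕ ls ≤ sumℕ ks
sumℕ-mono []          = ℕ.z≤n
sumℕ-mono (l≤k ∷ pw) = ℕₚ.+-mono-≤ l≤k (sumℕ-mono pw)

SameV₀ : ℕ → ℕ → Set
SameV₀ k l = δ₀ k ≡ δ₀ l

v₀-count-SameV₀ : ∀ {ks ls} → Pointwise SameV₀ ks ls → v₀-count ks ≡ v₀-count ls
v₀-count-SameV₀ []         = refl
v₀-count-SameV₀ (e ∷ same) = cong₂ _+_ e (v₀-count-SameV₀ same)

binomials≡0⊎SameV₀ : ∀ {R : ℕ → ℕ → Set} {ks ls} → Pointwise R ks ls →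
  prodℚ (zipWithB ks ls) ≡ 0ℚ ⊎ Pointwise SameV₀ ks ls
binomials≡0⊎SameV₀ [] = inj₂ []
binomials≡0⊎SameV₀ {ks = zero ∷ ks} {zero ∷ ls} (_ ∷ pw) =
  Sum.map (λ p≡0 → trans (cong (1ℚ *_) p≡0) (ℚₚ.*-zeroʳ 1ℚ)) (refl ∷_) (binomials≡0⊎SameV₀ pw)
binomials≡0⊎SameV₀ {ks = zero ∷ ks} {suc l ∷ ls} (_ ∷ _) =
  inj₁ (ℚₚ.*-zeroˡ (prodℚ (zipWithB ks ls)))
binomials≡0⊎SameV₀ {ks = suc k ∷ ks} {zero ∷ ls} (_ ∷ _) =
  inj₁ (ℚₚ.*-zeroˡ (prodℚ (zipWithB ks ls)))
binomials≡0⊎SameV₀ {ks = suc k ∷ ks} {suc l ∷ ls} (_ ∷ pw) =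
  Sum.map (λ p≡0 → trans (cong (b *_) p≡0) (ℚₚ.*-zeroʳ b)) (refl ∷_) (binomials≡0⊎SameV₀ pw)
  where b = ℕtoℚ (binom₋₁ (suc k) (suc l))

mult≡0⊎SameV₀ : ∀ {R : ℕ → ℕ → Set} {ks ls} → Pointwise R ks ls →
  mult ks ls ≡ 0ℚ ⊎ Pointwise SameV₀ ks ls
mult≡0⊎SameV₀ {ks = ks} {ls} pw =
  Sum.map₁ (λ p≡0 → trans (cong (s *_) p≡0) (ℚₚ.*-zeroʳ s)) (binomials≡0⊎SameV₀ pw)
  where s = sign (sumℕ ks + sumℕ ls)

relabel'-pointwise : ∀ {R : ℕ → ℕ → Set} t {ks ls} → Pointwise R (leaves t ++ ks) ls →
  Pointwise R (leaves t) (leaves (proj₁ (relabel' t ls))) × Pointwise R ks (proj₂ (relabel' t ls))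
relabel'-pointwise (leaf k) (r ∷ pw) = r ∷ [] , pw
relabel'-pointwise {R} (node a b) {ks} {ls} pw =
  let pa , pw′  = relabel'-pointwise a
                    (subst (λ z → Pointwise R z ls) (++-assoc (leaves a) (leaves b) ks) pw)
      pb , pw′′ = relabel'-pointwise b pw′
  in Pointwise.++⁺ pa pb , pw′′

relabel-pointwise : ∀ {R : ℕ → ℕ → Set} t {ls} → Pointwise R (leaves t) ls →
  Pointwise R (leaves t) (leaves (relabel t ls))
relabel-pointwise {R} t {ls} pw =
  proj₁ (relabel'-pointwise t (subst (λ z → Pointwise R z ls) (sym (++-identityʳ (leaves t))) pw))

v₀-countᵗ-relabel : ∀ t {ls} → Pointwise SameV₀ (leaves t) ls →
  v₀-countᵗ (relabel t ls) ≡ v₀-countᵗ t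
v₀-countᵗ-relabel t {ls} same = begin
  v₀-countᵗ (relabel t ls)         ≡⟨ v₀-countᵗ≡v₀-count-leaves (relabel t ls) ⟩
  v₀-count (leaves (relabel t ls)) ≡⟨ sym (v₀-count-SameV₀ (relabel-pointwise t same)) ⟩
  v₀-count (leaves t)              ≡⟨ sym (v₀-countᵗ≡v₀-count-leaves t) ⟩
  v₀-countᵗ t                      ∎
  where open ≡-Reasoning

δ₀-new-letter : ∀ s {m n} → n ≤ m → δ₀ (suc s + m ∸ n) ≡ 0
δ₀-new-letter s n≤m = cong δ₀ (ℕₚ.+-∸-assoc (suc s) n≤m)

▷ₘ-homogeneous : ∀ t u → Homogeneous v₀-countᵗ (v₀-countᵗ t + v₀-countᵗ u) (t ▷ₘ u)
▷ₘ-homogeneous t (leaf zero)    = []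
▷ₘ-homogeneous t (leaf (suc s)) = map⁺ (All.map term (boxes-bounded (leaves t)))
  where
  term : ∀ {ls} → Pointwise _≥_ (leaves t) ls →
    mult (leaves t) ls ≡ 0ℚ ⊎
    δ₀ (suc s + sumℕ (leaves t) ∸ sumℕ ls) + v₀-countᵗ (relabel t ls) ≡ v₀-countᵗ t + 0
  term pw = Sum.map₂
    (λ same → trans (cong₂ _+_ (δ₀-new-letter s (sumℕ-mono pw)) (v₀-countᵗ-relabel t same))
                    (sym (ℕₚ.+-identityʳ (v₀-countᵗ t))))
    (mult≡0⊎SameV₀ pw)
▷ₘ-homogeneous t (node a b) =
  ++⁺ (Homogeneous-mapKeys (λ a′ → node a′ b) (degree-raiseˡ T A B) (▷ₘ-homogeneous t a))
      (Homogeneous-mapKeys (node a) (degree-raiseʳ T A B) (▷ₘ-homogeneous t b))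
  where
  T = v₀-countᵗ t
  A = v₀-countᵗ a
  B = v₀-countᵗ b

▷ₘ*-homogeneous : ∀ t {n M} → Homogeneous v₀-countᵗ n M →
  Homogeneous v₀-countᵗ (v₀-countᵗ t + n) (t ▷ₘ* M)
▷ₘ*-homogeneous t = Homogeneous-linear _*_ ℚₚ.*-zeroˡ ℚₚ.*-zeroʳ
  λ u u≡n → subst (λ k → Homogeneous v₀-countᵗ (v₀-countᵗ t + k) (t ▷ₘ u)) u≡n (▷ₘ-homogeneous t u)

actU-homogeneous : ∀ t A → Homogeneous v₀-countᶠ (v₀-countᵗ t + v₀-countᶠ A) (actU t A)
actU-homogeneous t []       = []
actU-homogeneous t (u ∷ us) =
  ++⁺ (Homogeneous-mapKeys (_∷ us) (degree-raiseˡ T U Us) (▷ₘ-homogeneous t u))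
      (Homogeneous-mapKeys (u ∷_) (degree-raiseʳ T U Us) (actU-homogeneous t us))
  where
  T = v₀-countᵗ t
  U = v₀-countᵗ u
  Us = v₀-countᶠ us

actL-homogeneous : ∀ n A u → Homogeneous v₀-countᵗ (v₀-countᶠ A + v₀-countᵗ u) (actL n A u)
actL-homogeneous _       []      u = inj₂ refl ∷ []
actL-homogeneous zero    (t ∷ A) u = []
actL-homogeneous (suc n) (t ∷ A) u =
  ++⁺ (subst (λ k → Homogeneous v₀-countᵗ k (t ▷ₘ* actL n A u))
             (sym (ℕₚ.+-assoc (v₀-countᵗ t) (v₀-countᶠ A) (v₀-countᵗ u)))
             (▷ₘ*-homogeneous t (actL-homogeneous n A u)))
      (Homogeneous-linear (λ c d → - (c * d))
         (λ d → cong -_ (ℚₚ.*-zeroˡ d)) (λ c → cong -_ (ℚₚ.*-zeroʳ c))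
         (λ A′ A′≡ → subst (λ k → Homogeneous v₀-countᵗ (k + v₀-countᵗ u) (actL n A′ u))
                           A′≡ (actL-homogeneous n A′ u))
         (actU-homogeneous t A))

lieW-homogeneous : ∀ t → Homogeneous v₀-count (v₀-countᵗ t) (lieW t)
lieW-homogeneous (leaf k)   = inj₂ (ℕₚ.+-identityʳ (δ₀ k)) ∷ []
lieW-homogeneous (node a b) =
  ++⁺ (Homogeneous-· (lieW-homogeneous a) (lieW-homogeneous b))
      (Homogeneous-mapCoeff (ℚₚ.*-zeroʳ (- 1ℚ))
        (subst (λ k → Homogeneous v₀-count k (lieW b · lieW a))
               (ℕₚ.+-comm (v₀-countᵗ b) (v₀-countᵗ a))
               (Homogeneous-· (lieW-homogeneous b) (lieW-homogeneous a))))

lieP-homogeneous : ∀ {n M} → Homogeneous v₀-countᵗ n M → Homogeneous v₀-count n (lieP M)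
lieP-homogeneous = Homogeneous-linear _*_ ℚₚ.*-zeroˡ ℚₚ.*-zeroʳ
  λ t t≡n → subst (λ k → Homogeneous v₀-count k (lieW t)) t≡n (lieW-homogeneous t)

▷L-homogeneous : ∀ A b → Homogeneous v₀-count (v₀-count A + δ₀ b) (lieP (A ▷L leaf b))
▷L-homogeneous A b = lieP-homogeneous
  (subst (λ k → Homogeneous v₀-countᵗ (k + δ₀ b) (A ▷L leaf b)) (v₀-countᶠ-map-leaf A)
         (actL-homogeneous (length A) (map leaf A) (leaf b)))

▷W-graded : Graded _▷W_
▷W-graded []      []      = inj₂ refl ∷ []
▷W-graded (_ ∷ _) []      = inj₁ refl ∷ []
▷W-graded A       (b ∷ C) = Homogeneous-concatMap (λ {p} → term {p}) (splits-v₀-count A)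
  where
  term : ∀ {p} → DegreeSplit A p →
    Homogeneous v₀-count (v₀-count A + v₀-count (b ∷ C)) (lieP (proj₁ p ▷L leaf b) · (proj₂ p ▷W C))
  term {A₁ , A₂} split =
    subst (λ k → Homogeneous v₀-count k (lieP (A₁ ▷L leaf b) · (A₂ ▷W C)))
          (trans (interchange (v₀-count A₁) (δ₀ b) (v₀-count A₂) (v₀-count C))
                 (cong (_+ (δ₀ b + v₀-count C)) split))
          (Homogeneous-· (▷L-homogeneous A₁ b) (▷W-graded A₂ C))

⊛W-graded : Graded _⊛W_
⊛W-graded A B = Homogeneous-concatMap (λ {p} → term {p}) (splits-v₀-count A)
  where
  term : ∀ {p} → DegreeSplit A p →
    Homogeneous v₀-count (v₀-count A + v₀-count B) (word (proj₁ p) · (proj₂ p ▷W B))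
  term {A₁ , A₂} split =
    subst (λ k → Homogeneous v₀-count k (word A₁ · (A₂ ▷W B)))
          (trans (sym (ℕₚ.+-assoc (v₀-count A₁) (v₀-count A₂) (v₀-count B)))
                 (cong (_+ v₀-count B) split))
          (Homogeneous-· (word-homogeneous A₁) (▷W-graded A₂ B))

⊛ₐ-homogeneous : ∀ {m n P R} → Homogeneous v₀-count m P → Homogeneous v₀-count n R →
  Homogeneous v₀-count (m + n) (P ⊛ₐ R)
⊛ₐ-homogeneous = Homogeneous-bilinear _⊛W_ ⊛W-graded

antipodeF-homogeneous : ∀ n w → Homogeneous v₀-count (v₀-count w) (antipodeF n w)
antipodeF-homogeneous _       []      = inj₂ refl ∷ []
antipodeF-homogeneous zero    (_ ∷ _) = []
antipodeF-homogeneous (suc n) (x ∷ w) = Homogeneous-concatMap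
  (λ { {a , []} _ → []
     ; {a , b ∷ bs} split → Homogeneous-mapCoeff (ℚₚ.*-zeroʳ (- 1ℚ))
         (subst (λ k → Homogeneous v₀-count k (antipodeF n a ⊛ₐ word (b ∷ bs))) split
                (⊛ₐ-homogeneous (antipodeF-homogeneous n a) (word-homogeneous (b ∷ bs)))) })
  (splits-v₀-count (x ∷ w))

pair : Poly → (Word → ℚ) → ℚ
pair P f = foldr ℚ._+_ 0ℚ (map (λ e → proj₁ e * f (proj₂ e)) P)

remove : Word → Poly → Poly
remove u []            = []
remove u ((c , w) ∷ P) = if w ≟w u then remove u P else (c , w) ∷ remove u P

coeff-remove-self : ∀ u P → coeff (remove u P) u ≡ 0ℚ
coeff-remove-self u [] = refl
coeff-remove-self u ((c , w) ∷ P) with w ≟w u in w≟u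
... | true  = coeff-remove-self u P
... | false rewrite w≟u = trans (ℚₚ.+-identityˡ _) (coeff-remove-self u P)

coeff-remove-other : ∀ u v P → v ≢ u → coeff (remove u P) v ≡ coeff P v
coeff-remove-other u v [] _ = refl
coeff-remove-other u v ((c , w) ∷ P) v≢u with w ≟w u in w≟u
... | true rewrite ≟w-true w≟u | ≟w-≢ (λ u≡v → v≢u (sym u≡v)) =
  trans (coeff-remove-other u v P v≢u) (sym (ℚₚ.+-identityˡ _))
... | false = cong ((if w ≟w v then c else 0ℚ) ℚ.+_) (coeff-remove-other u v P v≢u)

length-remove : ∀ u P → length (remove u P) ≤ length P
length-remove u [] = ℕ.z≤n
length-remove u ((c , w) ∷ P) with w ≟w u
... | true  = ℕₚ.m≤n⇒m≤1+n (length-remove u P)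
... | false = s≤s (length-remove u P)

length-remove-head : ∀ u c P → length (remove u ((c , u) ∷ P)) ≤ length P
length-remove-head u c P rewrite ≟w-refl u = length-remove u P

module _ (f : Word → ℚ) where

  open CommSemigroupProperties (CommutativeMonoid.commutativeSemigroup ℚₚ.+-0-commutativeMonoid)
    renaming (x∙yz≈y∙xz to +-left-comm)

  pair-remove : ∀ u P → pair P f ≡ pair (remove u P) f ℚ.+ coeff P u * f u
  pair-remove u [] = sym (trans (ℚₚ.+-identityˡ _) (ℚₚ.*-zeroˡ (f u)))
  pair-remove u ((c , w) ∷ P) with w ≟w u in w≟u
  ... | true rewrite ≟w-true w≟u = begin
    c * f u ℚ.+ pair P f         ≡⟨ cong (c * f u ℚ.+_) (pair-remove u P) ⟩
    c * f u ℚ.+ (R ℚ.+ C * f u)  ≡⟨ +-left-comm (c * f u) R (C * f u) ⟩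
    R ℚ.+ (c * f u ℚ.+ C * f u)  ≡⟨ cong (R ℚ.+_) (sym (ℚₚ.*-distribʳ-+ (f u) c C)) ⟩
    R ℚ.+ (c ℚ.+ C) * f u        ∎
    where
    open ≡-Reasoning
    R = pair (remove u P) f
    C = coeff P u
  ... | false = begin
    c * f w ℚ.+ pair P f                ≡⟨ cong (c * f w ℚ.+_) (pair-remove u P) ⟩
    c * f w ℚ.+ (R ℚ.+ C * f u)         ≡⟨ sym (ℚₚ.+-assoc (c * f w) R (C * f u)) ⟩
    c * f w ℚ.+ R ℚ.+ C * f u           ≡⟨ cong (λ x → c * f w ℚ.+ R ℚ.+ x * f u)
                                                (sym (ℚₚ.+-identityˡ C)) ⟩
    c * f w ℚ.+ R ℚ.+ (0ℚ ℚ.+ C) * f u  ∎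
    where
    open ≡-Reasoning
    R = pair (remove u P) f
    C = coeff P u

  pair≡0 : ∀ P → (∀ w → coeff P w ≡ 0ℚ ⊎ f w ≡ 0ℚ) → pair P f ≡ 0ℚ
  pair≡0 P = bounded (length P) P ℕₚ.≤-refl
    where
    bounded : ∀ n P → length P ≤ n → (∀ w → coeff P w ≡ 0ℚ ⊎ f w ≡ 0ℚ) → pair P f ≡ 0ℚ
    bounded _       []            _         _       = refl
    bounded (suc n) ((c , u) ∷ P) (s≤s |P|≤n) vanish = begin
      pair P′ f                                  ≡⟨ pair-remove u P′ ⟩
      pair (remove u P′) f ℚ.+ coeff P′ u * f u
        ≡⟨ cong₂ ℚ._+_ (bounded n (remove u P′) shorter vanish′) (head (vanish u)) ⟩
      0ℚ ℚ.+ 0ℚ                                  ∎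
      where
      open ≡-Reasoning
      P′ = (c , u) ∷ P
      shorter = ℕₚ.≤-trans (length-remove-head u c P) |P|≤n
      head : coeff P′ u ≡ 0ℚ ⊎ f u ≡ 0ℚ → coeff P′ u * f u ≡ 0ℚ
      head (inj₁ c≡0) = trans (cong (_* f u) c≡0) (ℚₚ.*-zeroˡ (f u))
      head (inj₂ f≡0) = trans (cong (coeff P′ u *_) f≡0) (ℚₚ.*-zeroʳ (coeff P′ u))
      vanish′ : ∀ v → coeff (remove u P′) v ≡ 0ℚ ⊎ f v ≡ 0ℚ
      vanish′ v with ≡-dec ℕ._≟_ v u
      ... | yes refl = inj₁ (coeff-remove-self u P′)
      ... | no v≢u   =
        subst (λ x → x ≡ 0ℚ ⊎ f v ≡ 0ℚ) (sym (coeff-remove-other u v P′ v≢u)) (vanish v)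

  InSub⇒pair≡0 : ∀ P → InSub P → (∀ w → NoV0 w → f w ≡ 0ℚ) → pair P f ≡ 0ℚ
  InSub⇒pair≡0 P insub f-vanish = pair≡0 P vanish
    where
    vanish : ∀ w → coeff P w ≡ 0ℚ ⊎ f w ≡ 0ℚ
    vanish w with coeff P w ℚₚ.≟ 0ℚ
    ... | yes coeff≡0 = inj₁ coeff≡0
    ... | no  coeff≢0 = inj₂ (f-vanish w (insub w coeff≢0))

coeff-++ : ∀ P Q w → coeff (P ++ Q) w ≡ coeff P w ℚ.+ coeff Q w
coeff-++ []            Q w = sym (ℚₚ.+-identityˡ _)
coeff-++ ((c , u) ∷ P) Q w =
  trans (cong (h ℚ.+_) (coeff-++ P Q w)) (sym (ℚₚ.+-assoc h (coeff P w) (coeff Q w)))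
  where h = if u ≟w w then c else 0ℚ

if-scale : ∀ b a c → (if b then a * c else 0ℚ) ≡ a * (if b then c else 0ℚ)
if-scale true  a c = refl
if-scale false a c = sym (ℚₚ.*-zeroʳ a)

coeff-scale : ∀ a P w → coeff (scale a P) w ≡ a * coeff P w
coeff-scale a []            w = sym (ℚₚ.*-zeroʳ a)
coeff-scale a ((c , u) ∷ P) w =
  trans (cong₂ ℚ._+_ (if-scale (u ≟w w) a c) (coeff-scale a P w))
        (sym (ℚₚ.*-distribˡ-+ a (if u ≟w w then c else 0ℚ) (coeff P w)))

coeff-linear : ∀ (F : Word → Poly) P x →
  coeff (concatMap (λ e → scale (proj₁ e) (F (proj₂ e))) P) x ≡ pair P (λ w → coeff (F w) x)
coeff-linear F []            x = refl
coeff-linear F ((c , w) ∷ P) x =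
  trans (coeff-++ (scale c (F w)) _ x) (cong₂ ℚ._+_ (coeff-scale c (F w) x) (coeff-linear F P x))

coeff-scaledLinear : ∀ c (F : Word → Poly) R x →
  coeff (concatMap (λ e → scale (c * proj₁ e) (F (proj₂ e))) R) x ≡ c * pair R (λ w → coeff (F w) x)
coeff-scaledLinear c F []            x = sym (ℚₚ.*-zeroʳ c)
coeff-scaledLinear c F ((d , w) ∷ R) x = begin
  coeff (scale (c * d) (F w) ++ rest) x           ≡⟨ coeff-++ (scale (c * d) (F w)) rest x ⟩
  coeff (scale (c * d) (F w)) x ℚ.+ coeff rest x  ≡⟨ cong₂ ℚ._+_ (coeff-scale (c * d) (F w) x)
                                                                 (coeff-scaledLinear c F R x) ⟩
  c * d * g w ℚ.+ c * pair R g                    ≡⟨ cong (ℚ._+ c * pair R g) (ℚₚ.*-assoc c d (g w)) ⟩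
  c * (d * g w) ℚ.+ c * pair R g                  ≡⟨ sym (ℚₚ.*-distribˡ-+ c (d * g w) (pair R g)) ⟩
  c * (d * g w ℚ.+ pair R g)                      ∎
  where
  open ≡-Reasoning
  rest = concatMap (λ e → scale (c * proj₁ e) (F (proj₂ e))) R
  g = λ w → coeff (F w) x

coeff-bilinear : ∀ op P R x →
  coeff (bilinear op P R) x ≡ pair P (λ u → pair R (λ w → coeff (op u w) x))
coeff-bilinear op []            R x = refl
coeff-bilinear op ((c , u) ∷ P) R x =
  trans (coeff-++ (concatMap (λ e → scale (c * proj₁ e) (op u (proj₂ e))) R) _ x)
        (cong₂ ℚ._+_ (coeff-scaledLinear c (op u) R x) (coeff-bilinear op P R x))

Δ-word : Word → Poly2
Δ-word x = map (λ p → (1ℚ , p)) (splits x)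

Δ-word-homogeneous : ∀ x → Homogeneous v₀-count₂ (v₀-count x) (Δ-word x)
Δ-word-homogeneous x = map⁺ (All.map inj₂ (splits-v₀-count x))

coeff2-++ : ∀ T U u w → coeff2 (T ++ U) u w ≡ coeff2 T u w ℚ.+ coeff2 U u w
coeff2-++ []                  U u w = sym (ℚₚ.+-identityˡ _)
coeff2-++ ((c , a , b) ∷ T) U u w =
  trans (cong (h ℚ.+_) (coeff2-++ T U u w)) (sym (ℚₚ.+-assoc h (coeff2 T u w) (coeff2 U u w)))
  where h = if a ≟w u then (if b ≟w w then c else 0ℚ) else 0ℚ

if2-scale : ∀ b₁ b₂ c →
  (if b₁ then (if b₂ then c else 0ℚ) else 0ℚ) ≡ c * (if b₁ then (if b₂ then 1ℚ else 0ℚ) else 0ℚ)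
if2-scale true  true  c = sym (ℚₚ.*-identityʳ c)
if2-scale true  false c = sym (ℚₚ.*-zeroʳ c)
if2-scale false _     c = sym (ℚₚ.*-zeroʳ c)

coeff2-Δ-word-scale : ∀ c x u w →
  coeff2 (map (λ p → (c , p)) (splits x)) u w ≡ c * coeff2 (Δ-word x) u w
coeff2-Δ-word-scale c x u w = go (splits x)
  where
  go : ∀ S → coeff2 (map (λ p → (c , p)) S) u w ≡ c * coeff2 (map (λ p → (1ℚ , p)) S) u w
  go []            = sym (ℚₚ.*-zeroʳ c)
  go ((a , b) ∷ S) = trans (cong₂ ℚ._+_ (if2-scale (a ≟w u) (b ≟w w) c) (go S))
                           (sym (ℚₚ.*-distribˡ-+ c _ _))

coeff2-Δ : ∀ P u w → coeff2 (Δ P) u w ≡ pair P (λ x → coeff2 (Δ-word x) u w)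
coeff2-Δ []            u w = refl
coeff2-Δ ((c , x) ∷ P) u w =
  trans (coeff2-++ (map (λ p → (c , p)) (splits x)) (Δ P) u w)
        (cong₂ ℚ._+_ (coeff2-Δ-word-scale c x u w) (coeff2-Δ P u w))

coeff2-homogeneous : ∀ {n T u w} → Homogeneous v₀-count₂ n T → v₀-count₂ (u , w) ≢ n →
  coeff2 T u w ≡ 0ℚ
coeff2-homogeneous {T = []} [] _ = refl
coeff2-homogeneous {n} {(c , a , b) ∷ T} {u} {w} (hab ∷ hom) uw≢n =
  trans (cong₂ ℚ._+_ (head hab) (coeff2-homogeneous hom uw≢n)) (ℚₚ.+-identityˡ 0ℚ)
  where
  head : c ≡ 0ℚ ⊎ v₀-count₂ (a , b) ≡ n →
    (if a ≟w u then (if b ≟w w then c else 0ℚ) else 0ℚ) ≡ 0ℚ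
  head hab with a ≟w u in a≟u | b ≟w w in b≟w
  head _            | false | _     = refl
  head _            | true  | false = refl
  head (inj₁ c≡0)   | true  | true  = c≡0
  head (inj₂ ab≡n)  | true  | true  = ⊥-elim (uw≢n
    (subst₂ (λ a′ b′ → v₀-count₂ (a′ , b′) ≡ n) (≟w-true a≟u) (≟w-true b≟w) ab≡n))

-- The two Hopf subalgebras

NoV0⇒v₀-count≢ : ∀ {x n} → NoV0 x → n ≢ 0 → v₀-count x ≢ n
NoV0⇒v₀-count≢ clean n≢0 x≡n = n≢0 (trans (sym x≡n) (NoV0⇒v₀-count≡0 clean))

InSub-intro : ∀ P → (∀ w → v₀-count w ≢ 0 → coeff P w ≡ 0ℚ) → InSub P
InSub-intro P vanish w coeff≢0 with v₀-count w ℕ.≟ 0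
... | yes w₀≡0 = v₀-count≡0⇒NoV0 w w₀≡0
... | no  w₀≢0 = ⊥-elim (coeff≢0 (vanish w w₀≢0))

InSub-one : InSub one
InSub-one = InSub-intro one (λ w → coeff-homogeneous {w = w} (word-homogeneous []))

InSub-bilinear : ∀ op → Graded op → ∀ P R → InSub P → InSub R → InSub (bilinear op P R)
InSub-bilinear op graded P R insP insR = InSub-intro (bilinear op P R) λ x x₀≢0 →
  trans (coeff-bilinear op P R x)
    (InSub⇒pair≡0 (λ u → pair R (λ w → coeff (op u w) x)) P insP λ u u-clean →
     InSub⇒pair≡0 (λ w → coeff (op u w) x) R insR λ w w-clean →
      coeff-homogeneous (graded u w) (λ x≡uw → x₀≢0 (trans x≡uw
        (cong₂ _+_ (NoV0⇒v₀-count≡0 u-clean) (NoV0⇒v₀-count≡0 w-clean)))))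

InSub-⊛ₐ : ∀ P R → InSub P → InSub R → InSub (P ⊛ₐ R)
InSub-⊛ₐ = InSub-bilinear _⊛W_ ⊛W-graded

InSub-⧢ : ∀ P R → InSub P → InSub R → InSub (P ⧢ R)
InSub-⧢ = InSub-bilinear shuffleW shuffleW-graded

InSub2-Δ : ∀ P → InSub P → InSub2 (Δ P)
InSub2-Δ P insP u w coeff≢0 with v₀-count₂ (u , w) ℕ.≟ 0
... | yes uw₀≡0 = v₀-count₂≡0⇒NoV0 u w uw₀≡0
... | no  uw₀≢0 = ⊥-elim (coeff≢0 (trans (coeff2-Δ P u w)
  (InSub⇒pair≡0 (λ x → coeff2 (Δ-word x) u w) P insP λ x x-clean →
    coeff2-homogeneous (Δ-word-homogeneous x) (λ uw≡x → NoV0⇒v₀-count≢ x-clean uw₀≢0 (sym uw≡x)))))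

InSub-antipode : ∀ P → InSub P → InSub (antipode P)
InSub-antipode P insP = InSub-intro (antipode P) λ x x₀≢0 →
  trans (coeff-linear antipodeW P x)
    (InSub⇒pair≡0 (λ w → coeff (antipodeW w) x) P insP λ w w-clean →
      coeff-homogeneous (antipodeF-homogeneous (length w) w)
        (λ x≡w → x₀≢0 (trans x≡w (NoV0⇒v₀-count≡0 w-clean))))

InSub⇒Δₐ-InSub2 : ∀ P → InSub P → Δₐ-InSub2 P
InSub⇒Δₐ-InSub2 P insP u v coeff≢0 with v₀-count₂ (u , v) ℕ.≟ 0
... | yes uv₀≡0 = v₀-count₂≡0⇒NoV0 u v uv₀≡0
... | no  uv₀≢0 = ⊥-elim (coeff≢0 (InSub⇒pair≡0 (coeff (word u ⊛ₐ word v)) P insP λ x x-clean →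
  coeff-homogeneous (⊛ₐ-homogeneous (word-homogeneous u) (word-homogeneous v))
                    (NoV0⇒v₀-count≢ x-clean uv₀≢0)))

InSub⇒antipodeᵗ-InSub : ∀ P → InSub P → antipodeᵗ-InSub P
InSub⇒antipodeᵗ-InSub P insP u coeff≢0 with v₀-count u ℕ.≟ 0
... | yes u₀≡0 = v₀-count≡0⇒NoV0 u u₀≡0
... | no  u₀≢0 = ⊥-elim (coeff≢0 (InSub⇒pair≡0 (coeff (antipodeW u)) P insP λ x x-clean →
  coeff-homogeneous (antipodeF-homogeneous (length u) u) (NoV0⇒v₀-count≢ x-clean u₀≢0)))

proposition4p32 :
    ( InSub one
    × (∀ P Q → InSub P → InSub Q → InSub (P ⊛ₐ Q))
    × (∀ P → InSub P → InSub2 (Δ P))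
    × (∀ P → InSub P → InSub (antipode P)) )
    ×
    ( InSub one
    × (∀ P Q → InSub P → InSub Q → InSub (P ⧢ Q))
    × (∀ P → InSub P → Δₐ-InSub2 P)
    × (∀ P → InSub P → antipodeᵗ-InSub P) )
proposition4p32 =
  (InSub-one , InSub-⊛ₐ , InSub2-Δ , InSub-antipode) ,
  (InSub-one , InSub-⧢ , InSub⇒Δₐ-InSub2 , InSub⇒antipodeᵗ-InSub)
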